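{- Let $n\in\mathbb{N}$, $k,l\in[n]$ and $\pi\in S_n$. Suppose $\mathrm{Desc}(\pi)\subseteq[k-1]$, $l\le\pi_k$, and either $k=1$ or the sequences $\pi_{k-1}\,(l-\tfrac12)$ and $\pi_{k-1}\,\pi_k$ are order-isomorphic. Then $\mathrm{Desc}(\pi)=\mathrm{Desc}(\pi[k\to l])$.
   Context: $S_n$ is the set of permutations of $[n]$, written as sequences $\pi_1\cdots\pi_n$. Two sequences are order-isomorphic if their entries are in the same relative order. $\mathrm{Desc}(\pi)=\{i:\pi_i>\pi_{i+1}\}$. For $\pi\in S_n$ and $k,l\in[n+1]$, $\pi[k\to l]\in S_{n+1}$ is the permutation order-isomorphic to the sequence $\pi_1\cdots\pi_{k-1}\,(l-\tfrac12)\,\pi_k\cdots\pi_n$. -}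

module Defs where

open import Data.Nat using (ℕ; zero; suc; _+_; _*_; _<_)
open import Data.Fin using (Fin; toℕ)
open import Data.Fin.Permutation using (Permutation′; _⟨$⟩ʳ_)
open import Data.Vec using (Vec; tabulate; lookup; insertAt)
open import Data.Product using (Σ; _×_)
open import Relation.Binary.PropositionalEquality using (_≡_)
open import Function.Bundles using (_⇔_)

-- Conventions: positions and values are 0-based internally (Fin n).
-- The one-line notation of π ∈ S_n, with entries in 1..n (paper's values).
seq : ∀ {n} → Permutation′ n → Vec ℕ n
seq π = tabulate (λ i → suc (toℕ (π ⟨$⟩ʳ i)))

OrderIso : ∀ {m} → Vec ℕ m → Vec ℕ m → Set
OrderIso xs ys = ∀ i j → (lookup xs i < lookup xs j) ⇔ (lookup ys i < lookup ys j)

-- Descent at 0-based position i (paper's descent i+1): x_i > x_{i+1}.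
Desc : ∀ {m} → Vec ℕ m → ℕ → Set
Desc {m} xs i = Σ (Fin m) λ p → Σ (Fin m) λ q →
  (toℕ p ≡ i) × (toℕ q ≡ suc i) × (lookup xs q < lookup xs p)

-- Doubling all values, so that half-integers l - 1/2 become the odd number 2l - 1.
dbl : ∀ {m} → Vec ℕ m → Vec ℕ m
dbl xs = tabulate (λ i → 2 * lookup xs i)

-- Descents only depend on the relative order of the entries, so they survive
-- doubling all values, which turns the inserted value l - 1/2 into the integer
-- 2l - 1. Inserting x before position k of a sequence v that ascends from k on
-- only creates two new adjacent pairs: x < v_k excludes a descent after x, the
-- ascents from k on are merely shifted, and the hypothesis on v_{k-1} makes the
-- comparison of v_{k-1} with x agree with that of v_{k-1} with v_k.
module Submission where

open import Defs
open import Data.Nat using (ℕ; zero; suc; _*_; _<_; _≤_; _∸_; s≤s; s<s⁻¹; s≤s⁻¹)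
open import Data.Nat.Properties
open import Data.Fin using (Fin; toℕ; inject₁; zero; suc; fromℕ<)
open import Data.Fin.Properties using (toℕ-inject₁; toℕ<n; toℕ-fromℕ<; toℕ-injective)
open import Data.Fin.Permutation using (Permutation′; _⟨$⟩ʳ_)
open import Data.Vec using (Vec; []; _∷_; insertAt; lookup)
open import Data.Vec.Properties using (lookup∘tabulate)
open import Data.Product using (Σ; _×_; _,_)
open import Data.Sum using (_⊎_; inj₁; inj₂)
open import Data.Empty using (⊥-elim)
open import Relation.Nullary using (¬_)
open import Relation.Binary using (tri<; tri≈; tri>)
open import Relation.Binary.PropositionalEquality
  using (_≡_; refl; sym; trans; cong; subst; subst₂)
open import Function.Bundles using (_⇔_; mk⇔; Equivalence)
import Function.Properties.Equivalence as ⇔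

private
  variable
    m : ℕ

OrderIso-sym : {u v : Vec ℕ m} → OrderIso u v → OrderIso v u
OrderIso-sym u≅v i j = ⇔.sym (u≅v i j)

OrderIso⇒Desc : {u v : Vec ℕ m} → OrderIso u v → ∀ i → Desc u i → Desc v i
OrderIso⇒Desc u≅v i (p , q , p≡i , q≡1+i , uq<up) =
  p , q , p≡i , q≡1+i , Equivalence.to (u≅v q p) uq<up

Desc-cong : (u v : Vec ℕ m) → OrderIso u v → ∀ i → Desc u i ⇔ Desc v i
Desc-cong u v u≅v i =
  mk⇔ (OrderIso⇒Desc {u = u} {v} u≅v i)
      (OrderIso⇒Desc {u = v} {u} (OrderIso-sym {u = u} {v} u≅v) i)

OrderIso-dbl : (v : Vec ℕ m) → OrderIso v (dbl v)
OrderIso-dbl v i j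
  rewrite lookup∘tabulate (λ p → 2 * lookup v p) i
        | lookup∘tabulate (λ p → 2 * lookup v p) j
  = mk⇔ (*-monoʳ-< 2) (*-cancelˡ-< 2 _ _)

Desc-dbl : (v : Vec ℕ m) → ∀ i → Desc v i ⇔ Desc (dbl v) i
Desc-dbl v = Desc-cong v (dbl v) (OrderIso-dbl v)

-- Lookup by a natural-number index; out-of-range indices give the junk value 0.
_!_ : Vec ℕ m → ℕ → ℕ
[]       ! _     = 0
(x ∷ xs) ! zero  = x
(x ∷ xs) ! suc j = xs ! j

!-toℕ : (v : Vec ℕ m) (p : Fin m) → v ! toℕ p ≡ lookup v p
!-toℕ (x ∷ v) zero    = refl
!-toℕ (x ∷ v) (suc p) = !-toℕ v p

!-fromℕ< : (v : Vec ℕ m) {j : ℕ} (j<m : j < m) → v ! j ≡ lookup v (fromℕ< j<m)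
!-fromℕ< v j<m = trans (cong (v !_) (sym (toℕ-fromℕ< j<m))) (!-toℕ v (fromℕ< j<m))

Desc! : Vec ℕ m → ℕ → Set
Desc! {m} v i = suc i < m × v ! suc i < v ! i

Desc⇔Desc! : (v : Vec ℕ m) (i : ℕ) → Desc v i ⇔ Desc! v i
Desc⇔Desc! {m} v i = mk⇔ to from
  where
  to : Desc v i → Desc! v i
  to (p , q , refl , q≡1+i , vq<vp) =
    subst (_< m) q≡1+i (toℕ<n q) ,
    subst₂ _<_ (trans (sym (!-toℕ v q)) (cong (v !_) q≡1+i)) (sym (!-toℕ v p)) vq<vp
  from : Desc! v i → Desc v i
  from (1+i<m , v1+i<vi) =
    fromℕ< i<m , fromℕ< 1+i<m , toℕ-fromℕ< i<m , toℕ-fromℕ< 1+i<m ,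
    subst₂ _<_ (!-fromℕ< v 1+i<m) (!-fromℕ< v i<m) v1+i<vi
    where i<m = <-trans (n<1+n i) 1+i<m

insertAt-!-< : (v : Vec ℕ m) (k : Fin (suc m)) (x : ℕ) {j : ℕ} →
  j < toℕ k → insertAt v k x ! j ≡ v ! j
insertAt-!-< (y ∷ v) (suc k) x {zero}  _         = refl
insertAt-!-< (y ∷ v) (suc k) x {suc j} (s≤s j<k) = insertAt-!-< v k x j<k

insertAt-!-≡ : (v : Vec ℕ m) (k : Fin (suc m)) (x : ℕ) → insertAt v k x ! toℕ k ≡ x
insertAt-!-≡ v       zero    x = refl
insertAt-!-≡ (y ∷ v) (suc k) x = insertAt-!-≡ v k x

insertAt-!-> : (v : Vec ℕ m) (k : Fin (suc m)) (x : ℕ) {j : ℕ} →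
  toℕ k ≤ j → insertAt v k x ! suc j ≡ v ! j
insertAt-!-> v       zero    x         _         = refl
insertAt-!-> (y ∷ v) (suc k) x {suc j} (s≤s k≤j) = insertAt-!-> v k x k≤j

module InsertBefore (v : Vec ℕ m) (k : Fin m) (x : ℕ) where

  K : ℕ
  K = toℕ k

  w : Vec ℕ (suc m)
  w = insertAt v (inject₁ k) x

  w-before : ∀ {j} → j < K → w ! j ≡ v ! j
  w-before j<K = insertAt-!-< v (inject₁ k) x (subst (_ <_) (sym (toℕ-inject₁ k)) j<K)

  w-at : w ! K ≡ x
  w-at = subst (λ j → w ! j ≡ x) (toℕ-inject₁ k) (insertAt-!-≡ v (inject₁ k) x)

  w-after : ∀ {j} → K ≤ j → w ! suc j ≡ v ! j
  w-after K≤j = insertAt-!-> v (inject₁ k) x (subst (_≤ _) (sym (toℕ-inject₁ k)) K≤j)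

  Desc!-before : ∀ {i} → suc i < K → Desc! v i ⇔ Desc! w i
  Desc!-before {i} 1+i<K = mk⇔
    (λ (_ , lt) → s≤s (<⇒≤ (<-trans 1+i<K (toℕ<n k))) ,
                  subst₂ _<_ (sym (w-before 1+i<K)) (sym (w-before i<K)) lt)
    (λ (_ , lt) → <-trans 1+i<K (toℕ<n k) ,
                  subst₂ _<_ (w-before 1+i<K) (w-before i<K) lt)
    where i<K = <-trans (n<1+n i) 1+i<K

  module _ (descents-before : ∀ i → Desc! v i → i < K)
           (x<vK : x < v ! K)
           (x-like-vK : ∀ j → suc j ≡ K → x < v ! j → v ! K < v ! j) where

    Desc!-boundary : ∀ {i} → suc i ≡ K → Desc! v i ⇔ Desc! w i
    Desc!-boundary {i} 1+i≡K = mk⇔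
      (λ (_ , v1+i<vi) → s≤s (<⇒≤ 1+i<m) ,
         subst₂ _<_ (sym w1+i≡x) (sym wi≡vi) (<-trans x<vK (subst (_< _) v1+i≡vK v1+i<vi)))
      (λ (_ , w1+i<wi) → 1+i<m ,
         subst (_< _) (sym v1+i≡vK)
           (x-like-vK i 1+i≡K (subst₂ _<_ w1+i≡x wi≡vi w1+i<wi)))
      where
      1+i<m = subst (_< m) (sym 1+i≡K) (toℕ<n k)
      v1+i≡vK = cong (v !_) 1+i≡K
      w1+i≡x = trans (cong (w !_) 1+i≡K) w-at
      wi≡vi = w-before (≤-reflexive 1+i≡K)

    no-Desc!-after : ∀ {i} → K ≤ i → ¬ Desc! w i
    no-Desc!-after K≤i with m≤n⇒m<n∨m≡n K≤i
    ... | inj₂ refl = λ (_ , lt) → <-asym x<vK (subst₂ _<_ (w-after ≤-refl) w-at lt)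
    no-Desc!-after {suc i} _ | inj₁ (s≤s K≤i) = λ (1+i<1+m , lt) →
      <⇒≱ (descents-before i (s<s⁻¹ 1+i<1+m ,
                              subst₂ _<_ (w-after (m≤n⇒m≤1+n K≤i)) (w-after K≤i) lt))
          K≤i

    Desc!-insertAt : ∀ i → Desc! v i ⇔ Desc! w i
    Desc!-insertAt i with <-cmp (suc i) K
    ... | tri< 1+i<K _ _ = Desc!-before 1+i<K
    ... | tri≈ _ 1+i≡K _ = Desc!-boundary 1+i≡K
    ... | tri> _ _ K<1+i = mk⇔
      (λ d → ⊥-elim (<⇒≱ (descents-before i d) (s≤s⁻¹ K<1+i)))
      (λ d → ⊥-elim (no-Desc!-after (s≤s⁻¹ K<1+i) d))

Desc-insertAt : (v : Vec ℕ m) (k : Fin m) (x : ℕ) →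
  (∀ i → Desc v i → i < toℕ k) →
  x < lookup v k →
  (∀ j → suc (toℕ j) ≡ toℕ k → x < lookup v j → lookup v k < lookup v j) →
  ∀ i → Desc v i ⇔ Desc (insertAt v (inject₁ k) x) i
Desc-insertAt {m} v k x descents-before x<vk x-like-vk i =
  ⇔.trans (Desc⇔Desc! v i)
    (⇔.trans (Desc!-insertAt descents-before! x<vK x-like-vK! i) (⇔.sym (Desc⇔Desc! w i)))
  where
  open InsertBefore v k x
  descents-before! : ∀ i → Desc! v i → i < K
  descents-before! i d = descents-before i (Equivalence.from (Desc⇔Desc! v i) d)
  x<vK : x < v ! K
  x<vK = subst (x <_) (sym (!-toℕ v k)) x<vk
  x-like-vK! : ∀ j → suc j ≡ K → x < v ! j → v ! K < v ! j
  x-like-vK! j 1+j≡K x<vj =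
    subst₂ _<_ (sym (!-toℕ v k)) (sym vj≡)
      (x-like-vk (fromℕ< j<m) (trans (cong suc (toℕ-fromℕ< j<m)) 1+j≡K) (subst (x <_) vj≡ x<vj))
    where
    j<m = <-trans (n<1+n j) (subst (_< m) (sym 1+j≡K) (toℕ<n k))
    vj≡ = !-fromℕ< v j<m

lookup-dbl-seq : (π : Permutation′ m) (p : Fin m) →
  lookup (dbl (seq π)) p ≡ 2 * suc (toℕ (π ⟨$⟩ʳ p))
lookup-dbl-seq π p =
  trans (lookup∘tabulate _ p) (cong (2 *_) (lookup∘tabulate _ p))

adjacent-order-agrees : (π : Permutation′ m) (k : Fin m) (x : ℕ) →
  (toℕ k ≡ 0 ⊎
    Σ (Fin m) λ j → (suc (toℕ j) ≡ toℕ k) ×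
      OrderIso (2 * suc (toℕ (π ⟨$⟩ʳ j)) ∷ x ∷ [])
               (2 * suc (toℕ (π ⟨$⟩ʳ j)) ∷ 2 * suc (toℕ (π ⟨$⟩ʳ k)) ∷ [])) →
  ∀ j → suc (toℕ j) ≡ toℕ k →
  x < lookup (dbl (seq π)) j → lookup (dbl (seq π)) k < lookup (dbl (seq π)) j
adjacent-order-agrees π k x (inj₁ k≡0) j 1+j≡k _ = ⊥-elim (1+n≢0 (trans 1+j≡k k≡0))
adjacent-order-agrees π k x (inj₂ (j′ , 1+j′≡k , iso)) j 1+j≡k x<2πj
  with refl ← toℕ-injective (suc-injective (trans 1+j≡k (sym 1+j′≡k))) =
  subst₂ _<_ (sym (lookup-dbl-seq π k)) (sym (lookup-dbl-seq π j))
    (Equivalence.to (iso (suc zero) zero) (subst (x <_) (lookup-dbl-seq π j) x<2πj))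

mainTheorem3 : (n : ℕ) (k l : Fin n) (π : Permutation′ n) →
    (∀ i → Desc (seq π) i → suc i < suc (toℕ k)) →
    suc (toℕ l) ≤ suc (toℕ (π ⟨$⟩ʳ k)) →
    (toℕ k ≡ 0 ⊎
      Σ (Fin n) λ j → (suc (toℕ j) ≡ toℕ k) ×
        OrderIso (2 * suc (toℕ (π ⟨$⟩ʳ j)) ∷ 2 * suc (toℕ l) ∸ 1 ∷ [])
                 (2 * suc (toℕ (π ⟨$⟩ʳ j)) ∷ 2 * suc (toℕ (π ⟨$⟩ʳ k)) ∷ [])) →
    (σ : Permutation′ (suc n)) →
    OrderIso (dbl (seq σ)) (insertAt (dbl (seq π)) (inject₁ k) (2 * suc (toℕ l) ∸ 1)) →
    ∀ i → Desc (seq π) i ⇔ Desc (seq σ) i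
mainTheorem3 n k l π descents-before l≤πk adjacent σ σ≅π[k→l] i =
  ⇔.trans (Desc-dbl (seq π) i)
    (⇔.trans (Desc-insertAt (dbl (seq π)) k x descents-before′ x<2πk
                 (adjacent-order-agrees π k x adjacent) i)
      (⇔.trans (⇔.sym (Desc-cong (dbl (seq σ)) (insertAt (dbl (seq π)) (inject₁ k) x) σ≅π[k→l] i))
        (⇔.sym (Desc-dbl (seq σ) i))))
  where
  x = 2 * suc (toℕ l) ∸ 1
  descents-before′ : ∀ i → Desc (dbl (seq π)) i → i < toℕ k
  descents-before′ i d =
    s<s⁻¹ (descents-before i (Equivalence.from (Desc-dbl (seq π) i) d))
  -- 2 * suc l reduces to suc x, so x < 2 * suc l holds by n<1+n.
  x<2πk : x < lookup (dbl (seq π)) k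
  x<2πk = subst (x <_) (sym (lookup-dbl-seq π k)) (<-≤-trans (n<1+n x) (*-monoʳ-≤ 2 l≤πk))
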